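{- Let $T$ be a finite rooted ordered tree with root $r$, let $v\in T\setminus\{r\}$ and let $w=\mathsf{pa}^*(v)$ be the parent of $v$ in the dual tree $T^*$. Then $T[v]\subset T^*[w]$.
   Context: $T[v]$ is the set of $v$ and its descendants in $T$; $T^*[w]$ the set of $w$ and its descendants in $T^*$. The dual $T^*$ has the same vertex set and root $r$, with parent function $\mathsf{pa}^*$; with $rmc_T(u)$ the rightmost child and $ils_T(u)$ the immediate left sibling of $u$ in $T$: (1a) $r$ has no parent in $T^*$; (1b) if $v=rmc_T(r)$ then $v$ is the rightmost child of $r$ in $T^*$; (2) if $v=rmc_T(u)$ with $u\ne r$, then $v$ is the immediate left sibling of $u$ in $T^*$; (3) if $v=ils_T(u)$, then $v$ is the rightmost child of $u$ in $T^*$. -}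

module Defs where

open import Data.Nat using (ℕ; suc)
open import Data.Fin using (Fin; toℕ)
open import Data.List using (List; length; lookup)
open import Data.Product using (∃; _×_)
open import Relation.Binary.PropositionalEquality using (_≡_; _≢_)
open import Relation.Binary.Construct.Closure.ReflexiveTransitive using (Star)

data Tree : Set where
  node : List Tree → Tree

children : Tree → List Tree
children (node ts) = ts

-- Vertices of a tree t: positions (paths from the root).
data Pos : Tree → Set where
  here  : ∀ {t} → Pos t
  there : ∀ {ts} (i : Fin (length ts)) → Pos (lookup ts i) → Pos (node ts)

root : ∀ {t} → Pos t
root = here

sub : ∀ {t} → Pos t → Tree
sub {t} here = t
sub (there i p) = sub p

-- Child u k v : v is the k-th child (0-based, left to right) of u in t.
data Child : ∀ {t} → Pos t → ℕ → Pos t → Set where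
  top  : ∀ {ts} (i : Fin (length ts)) → Child {node ts} here (toℕ i) (there i here)
  down : ∀ {ts} (j : Fin (length ts)) {u : Pos (lookup ts j)} {k : ℕ} {v : Pos (lookup ts j)} →
         Child u k v → Child {node ts} (there j u) k (there j v)

IsChild : ∀ {t} → Pos t → Pos t → Set
IsChild u v = ∃ λ k → Child u k v

IsRmc : ∀ {t} → Pos t → Pos t → Set
IsRmc u v = ∃ λ k → Child u k v × suc k ≡ length (children (sub u))

IsIls : ∀ {t} → Pos t → Pos t → Set
IsIls v u = ∃ λ p → ∃ λ k → Child p k v × Child p (suc k) u

-- PaStar v w : w = pa*(v), the parent of v in the dual tree T*, following rules
-- (1b), (2), (3).  Rule (2) (v is the immediate left sibling of u in T*) gives
-- pa*(v) = pa*(u).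
data PaStar {t : Tree} : Pos t → Pos t → Set where
  rmc-root : ∀ {v} → IsRmc root v → PaStar v root
  rmc-nonroot : ∀ {u v w} → IsRmc u v → u ≢ root → PaStar u w → PaStar v w
  ils : ∀ {u v} → IsIls v u → PaStar v u

IsChild* : ∀ {t} → Pos t → Pos t → Set
IsChild* w x = PaStar x w

_∈T[_] : ∀ {t} → Pos t → Pos t → Set
x ∈T[ v ] = Star IsChild v x

_∈T*[_] : ∀ {t} → Pos t → Pos t → Set
x ∈T*[ w ] = Star IsChild* w x

-- The children of a non-root vertex v are chained in T* towards w = pa*(v): the
-- rightmost child hangs below w by rule (2), and every other child below its
-- right sibling by rule (3).  So every child c of v lies in T*[w], and so does
-- pa*(c), which is either w or the right sibling of c.  Following a T-path
-- downwards from v, each step therefore stays inside T*[w].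
module Submission where

open import Defs
open import Relation.Binary.PropositionalEquality using (_≢_; _≡_; subst; sym; trans)
open import Data.Nat using (ℕ; zero; suc; _+_; _∸_; _≤_; _<_; s≤s)
open import Data.Nat.Properties using (m≤n⇒m<n∨m≡n; m≤n+m; m∸n+n≡m; +-suc)
open import Data.Fin using (fromℕ<)
open import Data.Fin.Properties using (toℕ<n; toℕ-fromℕ<)
open import Data.List using (length)
open import Data.Product using (∃; _×_; _,_)
open import Data.Sum using (_⊎_; inj₁; inj₂)
open import Relation.Binary.Construct.Closure.ReflexiveTransitive using (ε; _◅_; _◅◅_)

Child⇒< : ∀ {t} {u c : Pos t} {k} → Child u k c → k < length (children (sub u))
Child⇒< (top i)     = toℕ<n i
Child⇒< (down j ch) = Child⇒< ch

child-exists : ∀ {t} (u : Pos t) {k} → k < length (children (sub u)) → ∃ λ c → Child u k c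
child-exists {node ts} here k<n =
  there i here , subst (λ m → Child {node ts} here m (there i here)) (toℕ-fromℕ< k<n) (top i)
  where i = fromℕ< k<n
child-exists (there j u) k<n with child-exists u k<n
... | c , ch = there j c , down j ch

Child⇒≢root : ∀ {t} {u c : Pos t} {k} → Child u k c → c ≢ root
Child⇒≢root (top i)     ()
Child⇒≢root (down j ch) ()

rightmost-or-next-sibling : ∀ {t} {v c : Pos t} {k} → Child v k c →
                            IsRmc v c ⊎ ∃ λ c′ → Child v (suc k) c′
rightmost-or-next-sibling {v = v} {k = k} ch with m≤n⇒m<n∨m≡n (Child⇒< ch)
... | inj₂ last = inj₁ (k , ch , last)
... | inj₁ k+1<n = inj₂ (child-exists v k+1<n)

module _ {t} {v w : Pos t} (v≢root : v ≢ root) (pa*v≡w : PaStar v w) where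

  child∈T*[pa*] : ∀ {k c} → Child v k c → c ∈T*[ w ]
  child∈T*[pa*] {k} ch = by-right-siblings (length (children (sub v)) ∸ suc k) (m∸n+n≡m (Child⇒< ch)) ch
    where
    by-right-siblings : ∀ d {k c} → d + suc k ≡ length (children (sub v)) → Child v k c → c ∈T*[ w ]
    by-right-siblings zero    last ch = rmc-nonroot (_ , ch , last) v≢root pa*v≡w ◅ ε
    by-right-siblings (suc d) {k} e ch with child-exists v k+1<n
      where k+1<n = subst (suc (suc k) ≤_) e (s≤s (m≤n+m (suc k) d))
    ... | c′ , ch′ = by-right-siblings d (trans (+-suc d (suc k)) e) ch′ ◅◅ (ils (v , k , ch , ch′) ◅ ε)

  pa*-child∈T*[pa*] : ∀ {k c} → Child v k c → ∃ λ w′ → PaStar c w′ × w′ ∈T*[ w ]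
  pa*-child∈T*[pa*] {k} ch with rightmost-or-next-sibling ch
  ... | inj₁ rmc = w , rmc-nonroot rmc v≢root pa*v≡w , ε
  ... | inj₂ (c′ , ch′) = c′ , ils (v , k , ch , ch′) , child∈T*[pa*] ch′

corollary2 : (t : Tree) (v w : Pos t) → v ≢ root → PaStar v w →
             (x : Pos t) → x ∈T[ v ] → x ∈T*[ w ]
corollary2 t v w v≢root pa*v≡w .v ε = pa*v≡w ◅ ε
corollary2 t v w v≢root pa*v≡w x ((_ , ch) ◅ c→x) with pa*-child∈T*[pa*] v≢root pa*v≡w ch
... | w′ , pa*c≡w′ , w′∈T*[w] = w′∈T*[w] ◅◅ corollary2 t _ w′ (Child⇒≢root ch) pa*c≡w′ x c→x
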